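{- Let $D\ge2$, $N\in\{2D,2D+1\}$, and let $\Gamma$, $V$, $A^{(r)}$, $O$, $\Omega(u,v,w)$ and $\chi_\Omega$ be as in the context. Let $(x,y,0)\in O$ satisfy $|\Omega(x,y,0)|=N$. Then \[ A^{(1)}\chi_{\Omega(x,y,0)}=\chi_{\Omega(x-1,y,0)}=\chi_{\Omega(x+1,y,0)}, \] \[ A^{(2)}\chi_{\Omega(x,y,0)}=\chi_{\Omega(x,y-1,0)}=\chi_{\Omega(x,y+1,0)}, \] \[ A^{(3)}\chi_{\Omega(x,y,0)}=\chi_{\Omega(x,y,N-1)}=\chi_{\Omega(x,y,1)}, \] where all vertex labels are taken modulo $N$.
   Context: $\Gamma$ is the cycle graph on $X=\{0,\dots,N-1\}=\mathbb{Z}/N\mathbb{Z}$, with $x\sim y$ iff $x-y\equiv\pm1 \pmod N$; its diameter is $D$. $V$ has basis $X$ and $A_1x=(x-1)+(x+1)$. On $V^{\otimes3}$, $A^{(1)}=A_1\otimes I\otimes I$, $A^{(2)}=I\otimes A_1\otimes I$ and $A^{(3)}=I\otimes I\otimes A_1$. $\operatorname{Aut}(\Gamma)$ (dihedral of order $2N$) acts on $X^3$ diagonally. $\Omega(u,v,w)$ denotes the orbit containing $(u,v,w)$, and $\chi_\Omega=\sum_{(a,b,c)\in\Omega}a\otimes b\otimes c$. The set $O$ of representative triples is defined as follows: - If $N=2D$: $O=\{(x,y,0): 0\le x\le D,\ y\in\{0,D\}\}\cup\{(x,y,0): x\in X,\ 1\le y\le D-1\}$. - If $N=2D+1$: $O=\{(x,0,0):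 0\le x\le D\}\cup\{(x,y,0): x\in X,\ 1\le y\le D\}$. -}

module Defs where

open import Data.Nat as ℕ using (ℕ; zero; suc; NonZero)
open import Data.Nat.DivMod using (_mod_)
open import Data.Fin using (Fin; toℕ) renaming (zero to fzero; suc to fsuc)
open import Data.Fin.Properties using (_≟_; any?)
open import Data.Integer as ℤ using (ℤ; 0ℤ; 1ℤ)
open import Data.Bool using (Bool; true; false; if_then_else_)
open import Data.Bool.Properties using () renaming (_≟_ to _≟ᵇ_)
open import Data.Sum using (_⊎_)
open import Data.Product using (Σ; _×_; _,_)
open import Data.Product.Properties using (≡-dec)
open import Relation.Nullary using (Dec; yes; no)
open import Relation.Nullary.Decidable using (isYes; _×-dec_)
open import Relation.Binary.PropositionalEquality using (_≡_)

∑ : {n : ℕ} → (Fin n → ℤ) → ℤ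
∑ {zero}  f = 0ℤ
∑ {suc n} f = f fzero ℤ.+ ∑ (λ i → f (fsuc i))

∑ℕ : {n : ℕ} → (Fin n → ℕ) → ℕ
∑ℕ {zero}  f = 0
∑ℕ {suc n} f = f fzero ℕ.+ ∑ℕ (λ i → f (fsuc i))

module Cycle (N : ℕ) .{{_ : NonZero N}} where

  X : Set
  X = Fin N

  lbl : ℕ → X
  lbl m = m mod N

  _⊕_ : X → X → X
  a ⊕ b = lbl (toℕ a ℕ.+ toℕ b)

  ⊝_ : X → X
  ⊝ a = lbl (N ℕ.∸ toℕ a)

  _⊖_ : X → X → X
  a ⊖ b = a ⊕ (⊝ b)

  -- Vectors of V (basis X) and of V ⊗ V ⊗ V (basis X³), given by
  -- their coefficient functions (scalars in ℤ).
  V : Set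
  V = X → ℤ

  V³ : Set
  V³ = X → X → X → ℤ

  [_≟ℤ_] : X → X → ℤ
  [ a ≟ℤ b ] = if isYes (a ≟ b) then 1ℤ else 0ℤ

  -- A₁ x = (x - 1) + (x + 1), extended linearly:
  -- A₁ f = Σ_x f(x) ((x-1) + (x+1)); coefficient at y below.
  A₁ : V → V
  A₁ f y = ∑ (λ x → f x ℤ.* ([ y ≟ℤ (x ⊖ lbl 1) ] ℤ.+ [ y ≟ℤ (x ⊕ lbl 1) ]))

  -- A⁽¹⁾ = A₁ ⊗ I ⊗ I, A⁽²⁾ = I ⊗ A₁ ⊗ I, A⁽³⁾ = I ⊗ I ⊗ A₁
  A⁽¹⁾ A⁽²⁾ A⁽³⁾ : V³ → V³
  A⁽¹⁾ F a b c = A₁ (λ a' → F a' b c) a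
  A⁽²⁾ F a b c = A₁ (λ b' → F a b' c) b
  A⁽³⁾ F a b c = A₁ (λ c' → F a b c') c

  -- Aut(Γ) = dihedral group of order 2N: the maps x ↦ x + s and x ↦ -x + s.
  Aut : Set
  Aut = Bool × X

  act : Aut → X → X
  act (false , s) x = x ⊕ s
  act (true  , s) x = (⊝ x) ⊕ s

  InΩ : X → X → X → X → X → X → Set
  InΩ u v w a b c = Σ Aut λ g → (act g u , act g v , act g w) ≡ (a , b , c)

  InΩ? : ∀ u v w a b c → Dec (InΩ u v w a b c)
  InΩ? u v w a b c = any-aut
    where
      dec3 : ∀ g → Dec ((act g u , act g v , act g w) ≡ (a , b , c))
      dec3 g = ≡-dec _≟_ (≡-dec _≟_ _≟_) _ _
      any-aut : Dec (Σ Aut λ g → (act g u , act g v , act g w) ≡ (a , b , c))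
      any-aut with any? (λ s → dec3 (false , s)) | any? (λ s → dec3 (true , s))
      ... | yes (s , p) | _ = yes ((false , s) , p)
      ... | no _ | yes (s , p) = yes ((true , s) , p)
      ... | no ¬f | no ¬t = no λ { ((false , s) , p) → ¬f (s , p)
                                  ; ((true , s) , p) → ¬t (s , p) }

  -- χ_{Ω(u,v,w)} = Σ_{(a,b,c) ∈ Ω(u,v,w)} a ⊗ b ⊗ c
  χΩ : X → X → X → V³
  χΩ u v w a b c = if isYes (InΩ? u v w a b c) then 1ℤ else 0ℤ

  ∣Ω∣ : X → X → X → ℕ
  ∣Ω∣ u v w = ∑ℕ λ a → ∑ℕ λ b → ∑ℕ λ c →
                if isYes (InΩ? u v w a b c) then 1 else 0

  -- membership of (x,y,0) in the set O of representative triples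
  InO : ℕ → X → X → Set
  InO D x y =
    (N ≡ 2 ℕ.* D ×
      (((toℕ x ℕ.≤ D) × ((toℕ y ≡ 0) ⊎ (toℕ y ≡ D)))
       ⊎ ((1 ℕ.≤ toℕ y) × (toℕ y ℕ.≤ D ℕ.∸ 1))))
    ⊎
    (N ≡ suc (2 ℕ.* D) ×
      (((toℕ x ℕ.≤ D) × (toℕ y ≡ 0))
       ⊎ ((1 ℕ.≤ toℕ y) × (toℕ y ℕ.≤ D))))

-- Write δ(a,b,c) = (a - c, b - c) ∈ X × X. Rotations x ↦ x + s preserve δ and reflections
-- x ↦ -x + s negate it, and such a map is fixed by where it sends the last coordinate, so
-- Ω(u,v,w) is the set of triples with δ = ±δ(u,v,w). Over every first coordinate the orbit has
-- a triple with δ = d and one with δ = -d; these differ unless d = -d, so |Ω| = N forces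
-- d = -d, and then Ω = {δ = d}.
-- Each A⁽ʳ⁾ moves δ by ±t, with t = (1,0), (0,1) or (-1,-1); as t ≠ -t once N ≥ 3, the two
-- moved indicators have disjoint supports and add up to the indicator of {δ ∈ {d - t, d + t}}.
-- Since d + t = -(d - t), this is the orbit of any triple whose δ is d - t, or d + t.
module Submission where

open import Defs
open import Data.Nat using (ℕ; _≤_; _*_; _∸_; suc; NonZero)
open import Data.Sum using (_⊎_)
open import Data.Product using (_×_)
open import Relation.Binary.PropositionalEquality using (_≡_)

open import Algebra.Bundles using (AbelianGroup)
import Algebra.Construct.DirectProduct as DirectProduct
open import Algebra.Consequences.Propositional using (comm∧idˡ⇒id; comm∧invˡ⇒inv)
import Algebra.Properties.AbelianGroup as AbelianGroupProperties
import Algebra.Properties.CommutativeSemigroup as CommutativeSemigroupProperties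
open import Data.Bool using (true; false; if_then_else_)
open import Data.Fin using (Fin; toℕ; punchIn) renaming (zero to fzero; suc to fsuc)
open import Data.Fin.Properties using (toℕ-fromℕ<; toℕ-injective; toℕ<n; punchInᵢ≢i; _≟_)
open import Data.Integer as ℤ using (ℤ; 0ℤ; 1ℤ)
import Data.Integer.Properties as ℤ
open import Algebra.Properties.CommutativeMonoid.Sum ℤ.+-0-commutativeMonoid
  using (sum; sum-remove; sum-cong-≗; sum-replicate-zero; ∑-distrib-+)
open import Data.Nat using (zero; _+_; _<_; z≤n; s≤s; >-nonZero⁻¹)
open import Data.Nat.DivMod using (_%_; m%n<n; m<n⇒m%n≡m; n%n≡0; %-distribˡ-+)
open import Data.Nat.Properties
  using (+-comm; +-assoc; m∸n+n≡m; <⇒≤; <⇒≱; ≤-refl; ≤-trans; ≤-reflexive; m≤m+n; m≤n+m;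
         +-mono-≤; +-monoʳ-≤; *-monoʳ-≤; n≤1+n; m<m*n)
open import Data.Product using (_,_; proj₁; proj₂)
open import Data.Product.Relation.Binary.Pointwise.NonDependent using (×-decidable)
open import Data.Sum using (inj₁; inj₂)
open import Function.Base using (_∘_)
open import Function.Bundles using (_⇔_; mk⇔; Equivalence)
open import Function.Construct.Symmetry using (⇔-sym)
open import Level using (Level; 0ℓ)
open import Relation.Binary.Definitions using (Decidable)
import Relation.Binary.PropositionalEquality as ≡
open ≡ using (_≢_; module ≡-Reasoning)
open import Relation.Binary.PropositionalEquality.Algebra using (isMagma)
open import Relation.Nullary using (Dec; yes; no; ¬_; contradiction)
open import Relation.Nullary.Decidable using (isYes; _⊎-dec_; decidable-stable)

private
  variable
    p q : Level
    P : Set p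
    Q : Set q

𝟙 : Dec P → ℤ
𝟙 P? = if isYes P? then 1ℤ else 0ℤ

𝟙ℕ : Dec P → ℕ
𝟙ℕ P? = if isYes P? then 1 else 0

𝟙-cong : (P? : Dec P) (Q? : Dec Q) → P ⇔ Q → 𝟙 P? ≡ 𝟙 Q?
𝟙-cong (yes _) (yes _) _   = ≡.refl
𝟙-cong (no _)  (no _)  _   = ≡.refl
𝟙-cong (yes p) (no ¬q) P⇔Q = contradiction (Equivalence.to P⇔Q p) ¬q
𝟙-cong (no ¬p) (yes q) P⇔Q = contradiction (Equivalence.from P⇔Q q) ¬p

𝟙-⊎ : (P? : Dec P) (Q? : Dec Q) → (P → ¬ Q) → 𝟙 P? ℤ.+ 𝟙 Q? ≡ 𝟙 (P? ⊎-dec Q?)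
𝟙-⊎ (yes p) (yes q) P→¬Q = contradiction q (P→¬Q p)
𝟙-⊎ (yes _) (no _)  _    = ≡.refl
𝟙-⊎ (no _)  (yes _) _    = ≡.refl
𝟙-⊎ (no _)  (no _)  _    = ≡.refl

𝟙-yes : (P? : Dec P) → P → 𝟙 P? ≡ 1ℤ
𝟙-yes (yes _) _ = ≡.refl
𝟙-yes (no ¬p) p = contradiction p ¬p

𝟙-no : (P? : Dec P) → ¬ P → 𝟙 P? ≡ 0ℤ
𝟙-no (yes p) ¬p = contradiction p ¬p
𝟙-no (no _)  _  = ≡.refl

1≤𝟙ℕ : (P? : Dec P) → P → 1 ≤ 𝟙ℕ P?
1≤𝟙ℕ (yes _) _ = ≤-refl
1≤𝟙ℕ (no ¬p) p = contradiction p ¬p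

∑≡sum : ∀ {n} (f : Fin n → ℤ) → ∑ f ≡ sum f
∑≡sum {zero}  f = ≡.refl
∑≡sum {suc n} f = ≡.cong (ℤ._+_ (f fzero)) (∑≡sum (λ i → f (fsuc i)))

sum-pick : ∀ {n} (f : Fin n → ℤ) (i : Fin n) → (∀ j → j ≢ i → f j ≡ 0ℤ) → sum f ≡ f i
sum-pick {suc n} f i f≡0 = begin
  sum f                                ≡⟨ sum-remove f ⟩
  f i ℤ.+ sum (λ j → f (punchIn i j))  ≡⟨ ≡.cong (ℤ._+_ (f i)) (sum-cong-≗ {n} (λ j → f≡0 _ (punchInᵢ≢i i j))) ⟩
  f i ℤ.+ sum {n} (λ _ → 0ℤ)           ≡⟨ ≡.cong (ℤ._+_ (f i)) (sum-replicate-zero n) ⟩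
  f i ℤ.+ 0ℤ                           ≡⟨ ℤ.+-identityʳ (f i) ⟩
  f i                                  ∎
  where open ≡-Reasoning

sum-select : ∀ {n} {P : Fin n → Set p} (P? : ∀ j → Dec (P j)) (f : Fin n → ℤ) {i : Fin n} →
             P i → (∀ {j} → P j → j ≡ i) → sum (λ j → f j ℤ.* 𝟙 (P? j)) ≡ f i
sum-select P? f {i} Pi P⇒≡i = begin
  sum (λ j → f j ℤ.* 𝟙 (P? j))  ≡⟨ sum-pick _ i off-i ⟩
  f i ℤ.* 𝟙 (P? i)              ≡⟨ ≡.cong (f i ℤ.*_) (𝟙-yes (P? i) Pi) ⟩
  f i ℤ.* 1ℤ                    ≡⟨ ℤ.*-identityʳ (f i) ⟩
  f i                           ∎
  where
  open ≡-Reasoning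
  off-i : ∀ j → j ≢ i → f j ℤ.* 𝟙 (P? j) ≡ 0ℤ
  off-i j j≢i = ≡.trans (≡.cong (f j ℤ.*_) (𝟙-no (P? j) (j≢i ∘ P⇒≡i))) (ℤ.*-zeroʳ (f j))

∑ℕ-point : ∀ {n} (f : Fin n → ℕ) i → f i ≤ ∑ℕ f
∑ℕ-point f fzero    = m≤m+n (f fzero) _
∑ℕ-point f (fsuc i) = ≤-trans (∑ℕ-point (λ j → f (fsuc j)) i) (m≤n+m _ (f fzero))

∑ℕ-pair : ∀ {n} (f : Fin n → ℕ) {i j} → i ≢ j → f i + f j ≤ ∑ℕ f
∑ℕ-pair f {fzero}  {fzero}  i≢j = contradiction ≡.refl i≢j
∑ℕ-pair f {fzero}  {fsuc j} _   = +-monoʳ-≤ (f fzero) (∑ℕ-point (λ k → f (fsuc k)) j)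
∑ℕ-pair f {fsuc i} {fzero}  _   = ≤-trans (≤-reflexive (+-comm (f (fsuc i)) (f fzero)))
                                          (+-monoʳ-≤ (f fzero) (∑ℕ-point (λ k → f (fsuc k)) i))
∑ℕ-pair f {fsuc i} {fsuc j} i≢j =
  ≤-trans (∑ℕ-pair (λ k → f (fsuc k)) (i≢j ∘ ≡.cong fsuc)) (m≤n+m _ (f fzero))

∑ℕ²-pair : ∀ {m n} (f : Fin m → Fin n → ℕ) {i j i′ j′} → (i , j) ≢ (i′ , j′) →
           f i j + f i′ j′ ≤ ∑ℕ (λ k → ∑ℕ (f k))
∑ℕ²-pair f {i} {j} {i′} {j′} ij≢i′j′ with i ≟ i′
... | no i≢i′ = ≤-trans (+-mono-≤ (∑ℕ-point (f i) j) (∑ℕ-point (f i′) j′)) (∑ℕ-pair _ i≢i′)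
... | yes ≡.refl = ≤-trans (∑ℕ-pair (f i) (ij≢i′j′ ∘ ≡.cong (i ,_))) (∑ℕ-point _ i)

n*m≤∑ℕ : ∀ {n m} (f : Fin n → ℕ) → (∀ i → m ≤ f i) → n * m ≤ ∑ℕ f
n*m≤∑ℕ {zero}  f _   = z≤n
n*m≤∑ℕ {suc n} f m≤f = +-mono-≤ (m≤f fzero) (n*m≤∑ℕ (λ i → f (fsuc i)) (λ i → m≤f (fsuc i)))

module AbelianGroupLemmas {a ℓ} (G : AbelianGroup a ℓ) where
  open AbelianGroup G
  open AbelianGroupProperties G
  open CommutativeSemigroupProperties commutativeSemigroup
  open import Relation.Binary.Reasoning.Setoid setoid

  x≈z-y⇒x∙y≈z : ∀ {x y z} → x ≈ z - y → x ∙ y ≈ z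
  x≈z-y⇒x∙y≈z {y = y} {z} x≈z-y = trans (∙-congʳ x≈z-y) (//-rightDividesˡ y z)

  xs-ys≈x-y : ∀ x y s → x ∙ s - y ∙ s ≈ x - y
  xs-ys≈x-y x y s = begin
    (x ∙ s) ∙ (y ∙ s) ⁻¹       ≈⟨ ∙-congˡ (⁻¹-∙-comm y s) ⟨
    (x ∙ s) ∙ (y ⁻¹ ∙ s ⁻¹)    ≈⟨ interchange x s (y ⁻¹) (s ⁻¹) ⟩
    (x - y) ∙ (s ∙ s ⁻¹)       ≈⟨ ∙-congˡ (inverseʳ s) ⟩
    (x - y) ∙ ε                ≈⟨ identityʳ (x - y) ⟩
    x - y                      ∎

  x⁻¹-y⁻¹≈[x-y]⁻¹ : ∀ x y → x ⁻¹ - y ⁻¹ ≈ (x - y) ⁻¹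
  x⁻¹-y⁻¹≈[x-y]⁻¹ x y = ⁻¹-∙-comm x (y ⁻¹)

  x-yz≈x-y-z : ∀ x y z → x - y ∙ z ≈ x - y - z
  x-yz≈x-y-z x y z = trans (∙-congˡ (sym (⁻¹-∙-comm y z))) (sym (assoc x (y ⁻¹) (z ⁻¹)))

  infix 4 _∈±_
  _∈±_ : Carrier → Carrier → Set ℓ
  p ∈± d = p ≈ d ⊎ p ≈ d ⁻¹

  ∈±-cong : ∀ {p p′ d d′} → p ≈ p′ → d ≈ d′ → p ∈± d ⇔ p′ ∈± d′
  ∈±-cong p≈p′ d≈d′ = mk⇔
    (λ { (inj₁ p≈d)     → inj₁ (trans (sym p≈p′) (trans p≈d d≈d′))
       ; (inj₂ p≈d⁻¹)   → inj₂ (trans (sym p≈p′) (trans p≈d⁻¹ (⁻¹-cong d≈d′))) })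
    (λ { (inj₁ p′≈d′)   → inj₁ (trans p≈p′ (trans p′≈d′ (sym d≈d′)))
       ; (inj₂ p′≈d′⁻¹) → inj₂ (trans p≈p′ (trans p′≈d′⁻¹ (⁻¹-cong (sym d≈d′)))) })

  ∈±-⁻¹ : ∀ {p d} → p ∈± d ⇔ p ∈± d ⁻¹
  ∈±-⁻¹ {d = d} = mk⇔
    (λ { (inj₁ p≈d)   → inj₂ (trans p≈d (sym (⁻¹-involutive d)))
       ; (inj₂ p≈d⁻¹) → inj₁ p≈d⁻¹ })
    (λ { (inj₁ p≈d⁻¹)   → inj₂ p≈d⁻¹
       ; (inj₂ p≈d⁻¹⁻¹) → inj₁ (trans p≈d⁻¹⁻¹ (⁻¹-involutive d)) })

  module _ {d : Carrier} (d⁻¹≈d : d ⁻¹ ≈ d) where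

    ∈±⇒≈ : ∀ {p} → p ∈± d → p ≈ d
    ∈±⇒≈ (inj₁ p≈d)   = p≈d
    ∈±⇒≈ (inj₂ p≈d⁻¹) = trans p≈d⁻¹ d⁻¹≈d

    [d∙t]⁻¹≈d-t : ∀ t → (d ∙ t) ⁻¹ ≈ d - t
    [d∙t]⁻¹≈d-t t = trans (sym (⁻¹-∙-comm d t)) (∙-congʳ d⁻¹≈d)

    ∈±-neighbours : ∀ {p t} → (p ∙ t ∈± d ⊎ p - t ∈± d) ⇔ p ∈± d - t
    ∈±-neighbours {p} {t} = mk⇔
      (λ { (inj₁ pt∈±d)  → inj₁ (x≈z//y p t d (∈±⇒≈ pt∈±d))
         ; (inj₂ p-t∈±d) →
             inj₂ (trans (x≈z//y p (t ⁻¹) d (∈±⇒≈ p-t∈±d)) (sym ([d∙t]⁻¹≈d-t (t ⁻¹)))) })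
      (λ { (inj₁ p≈d-t)     → inj₁ (inj₁ (x≈z-y⇒x∙y≈z p≈d-t))
         ; (inj₂ p≈[d-t]⁻¹) →
             inj₂ (inj₁ (x≈z-y⇒x∙y≈z (trans p≈[d-t]⁻¹ ([d∙t]⁻¹≈d-t (t ⁻¹))))) })

    ∈±-neighbours-disjoint : ∀ {p t} → p ∙ t ∈± d → p - t ∈± d → t ⁻¹ ≈ t
    ∈±-neighbours-disjoint {p} {t} pt∈±d p-t∈±d =
      ∙-cancelˡ p (t ⁻¹) t (trans (∈±⇒≈ p-t∈±d) (sym (∈±⇒≈ pt∈±d)))

  module _ (_≈?_ : Decidable _≈_) where

    infix 4 _∈±?_
    _∈±?_ : Decidable _∈±_
    p ∈±? d = (p ≈? d) ⊎-dec (p ≈? (d ⁻¹))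

    χ± : Carrier → Carrier → ℤ
    χ± d p = 𝟙 (p ∈±? d)

    χ±-cong : ∀ {p p′ d d′} → p ≈ p′ → d ≈ d′ → χ± d p ≡ χ± d′ p′
    χ±-cong p≈p′ d≈d′ = 𝟙-cong _ _ (∈±-cong p≈p′ d≈d′)

    χ±-⁻¹ : ∀ {p d} → χ± (d ⁻¹) p ≡ χ± d p
    χ±-⁻¹ = 𝟙-cong _ _ (⇔-sym ∈±-⁻¹)

    module _ {d : Carrier} (d⁻¹≈d : d ⁻¹ ≈ d) where

      χ±-neighbours : ∀ {p t} → ¬ t ⁻¹ ≈ t → χ± d (p ∙ t) ℤ.+ χ± d (p - t) ≡ χ± (d - t) p
      χ±-neighbours {p} {t} t⁻¹≉t = ≡.trans
        (𝟙-⊎ (p ∙ t ∈±? d) (p - t ∈±? d) (λ ∈₊ ∈₋ → t⁻¹≉t (∈±-neighbours-disjoint d⁻¹≈d ∈₊ ∈₋)))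
        (𝟙-cong _ (p ∈±? d - t) (∈±-neighbours d⁻¹≈d))

      χ±-mirror : ∀ {p t} → χ± (d - t) p ≡ χ± (d ∙ t) p
      χ±-mirror {t = t} = ≡.trans (χ±-cong refl (sym ([d∙t]⁻¹≈d-t d⁻¹≈d t))) χ±-⁻¹

module CyclicGroup (N : ℕ) .{{_ : NonZero N}} where
  open Cycle N
  open ≡-Reasoning

  toℕ-lbl : ∀ m → toℕ (lbl m) ≡ m % N
  toℕ-lbl m = toℕ-fromℕ< (m%n<n m N)

  toℕ-lbl-< : ∀ {m} → m < N → toℕ (lbl m) ≡ m
  toℕ-lbl-< m<N = ≡.trans (toℕ-lbl _) (m<n⇒m%n≡m m<N)

  lbl-toℕ : ∀ a → lbl (toℕ a) ≡ a
  lbl-toℕ a = toℕ-injective (toℕ-lbl-< (toℕ<n a))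

  lbl-+ : ∀ m n → lbl m ⊕ lbl n ≡ lbl (m + n)
  lbl-+ m n = toℕ-injective (begin
    toℕ (lbl m ⊕ lbl n)              ≡⟨ toℕ-lbl (toℕ (lbl m) + toℕ (lbl n)) ⟩
    (toℕ (lbl m) + toℕ (lbl n)) % N  ≡⟨ ≡.cong₂ (λ i j → (i + j) % N) (toℕ-lbl m) (toℕ-lbl n) ⟩
    (m % N + n % N) % N              ≡⟨ %-distribˡ-+ m n N ⟨
    (m + n) % N                      ≡⟨ toℕ-lbl (m + n) ⟨
    toℕ (lbl (m + n))                ∎)

  lbl-N : lbl N ≡ lbl 0
  lbl-N = toℕ-injective (begin
    toℕ (lbl N)  ≡⟨ toℕ-lbl N ⟩
    N % N        ≡⟨ n%n≡0 N ⟩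
    0            ≡⟨ toℕ-lbl-< (>-nonZero⁻¹ N) ⟨
    toℕ (lbl 0)  ∎)

  ⊕-comm : ∀ a b → a ⊕ b ≡ b ⊕ a
  ⊕-comm a b = ≡.cong lbl (+-comm (toℕ a) (toℕ b))

  ⊕-assoc : ∀ a b c → (a ⊕ b) ⊕ c ≡ a ⊕ (b ⊕ c)
  ⊕-assoc a b c = begin
    (a ⊕ b) ⊕ c                        ≡⟨ ≡.cong ((a ⊕ b) ⊕_) (lbl-toℕ c) ⟨
    (a ⊕ b) ⊕ lbl (toℕ c)              ≡⟨ lbl-+ (toℕ a + toℕ b) (toℕ c) ⟩
    lbl (toℕ a + toℕ b + toℕ c)        ≡⟨ ≡.cong lbl (+-assoc (toℕ a) (toℕ b) (toℕ c)) ⟩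
    lbl (toℕ a + (toℕ b + toℕ c))      ≡⟨ lbl-+ (toℕ a) (toℕ b + toℕ c) ⟨
    lbl (toℕ a) ⊕ (b ⊕ c)              ≡⟨ ≡.cong (_⊕ (b ⊕ c)) (lbl-toℕ a) ⟩
    a ⊕ (b ⊕ c)                        ∎

  ⊕-identityˡ : ∀ a → lbl 0 ⊕ a ≡ a
  ⊕-identityˡ a = begin
    lbl 0 ⊕ a            ≡⟨ ≡.cong (lbl 0 ⊕_) (lbl-toℕ a) ⟨
    lbl 0 ⊕ lbl (toℕ a)  ≡⟨ lbl-+ 0 (toℕ a) ⟩
    lbl (toℕ a)          ≡⟨ lbl-toℕ a ⟩
    a                    ∎

  ⊝-inverseˡ : ∀ a → (⊝ a) ⊕ a ≡ lbl 0
  ⊝-inverseˡ a = begin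
    (⊝ a) ⊕ a                        ≡⟨ ≡.cong ((⊝ a) ⊕_) (lbl-toℕ a) ⟨
    (⊝ a) ⊕ lbl (toℕ a)            ≡⟨ lbl-+ (N ∸ toℕ a) (toℕ a) ⟩
    lbl (N ∸ toℕ a + toℕ a)      ≡⟨ ≡.cong lbl (m∸n+n≡m (<⇒≤ (toℕ<n a))) ⟩
    lbl N                          ≡⟨ lbl-N ⟩
    lbl 0                          ∎

  abelianGroup : AbelianGroup 0ℓ 0ℓ
  abelianGroup = record
    { Carrier        = X
    ; _≈_            = _≡_
    ; _∙_            = _⊕_
    ; ε              = lbl 0
    ; _⁻¹            = ⊝_
    ; isAbelianGroup = record
      { isGroup = record
        { isMonoid = record
          { isSemigroup = record { isMagma = isMagma _⊕_ ; assoc = ⊕-assoc }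
          ; identity    = comm∧idˡ⇒id ⊕-comm ⊕-identityˡ
          }
        ; inverse  = comm∧invˡ⇒inv ⊕-comm ⊝-inverseˡ
        ; ⁻¹-cong  = ≡.cong ⊝_
        }
      ; comm    = ⊕-comm
      }
    }

  ⊝1≢1 : 3 ≤ N → ⊝ lbl 1 ≢ lbl 1
  ⊝1≢1 3≤N ⊝1≡1 = 2≢0 (begin
    2            ≡⟨ toℕ-lbl-< 3≤N ⟨
    toℕ (lbl 2)  ≡⟨ ≡.cong toℕ lbl2≡lbl0 ⟩
    toℕ (lbl 0)  ≡⟨ toℕ-lbl-< (>-nonZero⁻¹ N) ⟩
    0            ∎)
    where
    2≢0 : 2 ≢ 0
    2≢0 ()
    lbl2≡lbl0 : lbl 2 ≡ lbl 0
    lbl2≡lbl0 = begin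
      lbl 2              ≡⟨ lbl-+ 1 1 ⟨
      lbl 1 ⊕ lbl 1      ≡⟨ ≡.cong (_⊕ lbl 1) ⊝1≡1 ⟨
      (⊝ lbl 1) ⊕ lbl 1  ≡⟨ ⊝-inverseˡ (lbl 1) ⟩
      lbl 0              ∎

  lbl[N∸1]≡⊝1 : 2 ≤ N → lbl (N ∸ 1) ≡ ⊝ lbl 1
  lbl[N∸1]≡⊝1 2≤N = ≡.cong (λ k → lbl (N ∸ k)) (≡.sym (toℕ-lbl-< 2≤N))

module Adjacency (N : ℕ) .{{_ : NonZero N}} where
  open Cycle N
  open CyclicGroup N using (abelianGroup)
  open AbelianGroupProperties abelianGroup using (//-rightDividesʳ; //-rightDividesˡ; x≈z//y)
  open AbelianGroupLemmas abelianGroup using (x≈z-y⇒x∙y≈z)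
  open ≡-Reasoning

  A₁-shift : ∀ f y → A₁ f y ≡ f (y ⊕ lbl 1) ℤ.+ f (y ⊖ lbl 1)
  A₁-shift f y = begin
    A₁ f y
      ≡⟨ ∑≡sum {N} _ ⟩
    sum (λ x → f x ℤ.* (𝟙 (y ≟ x ⊖ lbl 1) ℤ.+ 𝟙 (y ≟ x ⊕ lbl 1)))
      ≡⟨ sum-cong-≗ {N} (λ x → ℤ.*-distribˡ-+ (f x) _ _) ⟩
    sum (λ x → f x ℤ.* 𝟙 (y ≟ x ⊖ lbl 1) ℤ.+ f x ℤ.* 𝟙 (y ≟ x ⊕ lbl 1))
      ≡⟨ ∑-distrib-+ {N} _ _ ⟩
    sum (λ x → f x ℤ.* 𝟙 (y ≟ x ⊖ lbl 1)) ℤ.+ sum (λ x → f x ℤ.* 𝟙 (y ≟ x ⊕ lbl 1))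
      ≡⟨ ≡.cong₂ ℤ._+_ (sum-select (λ x → y ≟ x ⊖ lbl 1) f y≡[y+1]-1 y≡x-1⇒x≡y+1)
                       (sum-select (λ x → y ≟ x ⊕ lbl 1) f y≡[y-1]+1 y≡x+1⇒x≡y-1) ⟩
    f (y ⊕ lbl 1) ℤ.+ f (y ⊖ lbl 1)
      ∎
    where
    y≡[y+1]-1 : y ≡ (y ⊕ lbl 1) ⊖ lbl 1
    y≡[y+1]-1 = ≡.sym (//-rightDividesʳ (lbl 1) y)
    y≡x-1⇒x≡y+1 : ∀ {x} → y ≡ x ⊖ lbl 1 → x ≡ y ⊕ lbl 1
    y≡x-1⇒x≡y+1 y≡x-1 = ≡.sym (x≈z-y⇒x∙y≈z y≡x-1)
    y≡[y-1]+1 : y ≡ (y ⊖ lbl 1) ⊕ lbl 1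
    y≡[y-1]+1 = ≡.sym (//-rightDividesˡ (lbl 1) y)
    y≡x+1⇒x≡y-1 : ∀ {x} → y ≡ x ⊕ lbl 1 → x ≡ y ⊖ lbl 1
    y≡x+1⇒x≡y-1 {x} y≡x+1 = x≈z//y x (lbl 1) y (≡.sym y≡x+1)

module Orbits (N : ℕ) .{{_ : NonZero N}} where
  open Cycle N
  open CyclicGroup N using (abelianGroup; ⊝1≢1; lbl[N∸1]≡⊝1)
  open Adjacency N using (A₁-shift)
  module ℤ/N where
    open AbelianGroup abelianGroup public
    open AbelianGroupProperties abelianGroup public
    open CommutativeSemigroupProperties commutativeSemigroup public
    open AbelianGroupLemmas abelianGroup public
  module X² = AbelianGroup (DirectProduct.abelianGroup abelianGroup abelianGroup)
  open X² using (_≈_; _∙_; _⁻¹; _-_)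
  open AbelianGroupLemmas (DirectProduct.abelianGroup abelianGroup abelianGroup)

  infix 4 _≈?_
  _≈?_ : Decidable _≈_
  _≈?_ = ×-decidable _≟_ _≟_

  δ : X → X → X → X × X
  δ a b c = (a ⊖ c , b ⊖ c)

  δ-rotation : ∀ u v w s → δ (u ⊕ s) (v ⊕ s) (w ⊕ s) ≈ δ u v w
  δ-rotation u v w s = ℤ/N.xs-ys≈x-y u w s , ℤ/N.xs-ys≈x-y v w s

  δ-reflection : ∀ u v w s → δ ((⊝ u) ⊕ s) ((⊝ v) ⊕ s) ((⊝ w) ⊕ s) ≈ δ u v w ⁻¹
  δ-reflection u v w s =
    ≡.trans (ℤ/N.xs-ys≈x-y (⊝ u) (⊝ w) s) (ℤ/N.x⁻¹-y⁻¹≈[x-y]⁻¹ u w) ,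
    ≡.trans (ℤ/N.xs-ys≈x-y (⊝ v) (⊝ w) s) (ℤ/N.x⁻¹-y⁻¹≈[x-y]⁻¹ v w)

  rotation-hit : ∀ w c → act (false , c ⊖ w) w ≡ c
  rotation-hit w c = ≡.trans (ℤ/N.comm w (c ⊖ w)) (ℤ/N.//-rightDividesˡ w c)

  reflection-hit : ∀ w c → act (true , c ⊕ w) w ≡ c
  reflection-hit w c = ≡.trans (ℤ/N.comm (⊝ w) (c ⊕ w)) (ℤ/N.//-rightDividesʳ w c)

  InΩ-intro : ∀ {u v w a b c} g → act g w ≡ c → δ (act g u) (act g v) (act g w) ≈ δ a b c →
              InΩ u v w a b c
  InΩ-intro {c = c} g ≡.refl (a-c≡ , b-c≡) =
    g , ≡.cong₂ (λ a b → a , b , c) (ℤ/N.∙-cancelʳ (⊝ c) _ _ a-c≡) (ℤ/N.∙-cancelʳ (⊝ c) _ _ b-c≡)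

  InΩ⇒∈± : ∀ {u v w a b c} → InΩ u v w a b c → δ a b c ∈± δ u v w
  InΩ⇒∈± {u} {v} {w} ((false , s) , ≡.refl) = inj₁ (δ-rotation u v w s)
  InΩ⇒∈± {u} {v} {w} ((true  , s) , ≡.refl) = inj₂ (δ-reflection u v w s)

  ∈±⇒InΩ : ∀ {u v w a b c} → δ a b c ∈± δ u v w → InΩ u v w a b c
  ∈±⇒InΩ {u} {v} {w} {c = c} (inj₁ δ≈) =
    InΩ-intro (false , c ⊖ w) (rotation-hit w c)
              (X².trans (δ-rotation u v w (c ⊖ w)) (X².sym δ≈))
  ∈±⇒InΩ {u} {v} {w} {c = c} (inj₂ δ≈) =
    InΩ-intro (true , c ⊕ w) (reflection-hit w c)
              (X².trans (δ-reflection u v w (c ⊕ w)) (X².sym δ≈))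

  χΩ≡χ± : ∀ u v w a b c → χΩ u v w a b c ≡ χ± _≈?_ (δ u v w) (δ a b c)
  χΩ≡χ± u v w a b c = 𝟙-cong (InΩ? u v w a b c) _ (mk⇔ InΩ⇒∈± ∈±⇒InΩ)

  fibre≥2 : ∀ {u v w} → ¬ δ u v w ⁻¹ ≈ δ u v w →
            ∀ a → 2 ≤ ∑ℕ λ b → ∑ℕ λ c → 𝟙ℕ (InΩ? u v w a b c)
  fibre≥2 {u} {v} {w} d⁻¹≉d a = ≤-trans
    (+-mono-≤ (1≤𝟙ℕ (InΩ? u v w a (act ρ v) (act ρ w)) (member ρ (rotation-hit u a)))
              (1≤𝟙ℕ (InΩ? u v w a (act σ v) (act σ w)) (member σ (reflection-hit u a))))
    (∑ℕ²-pair _ ρ≢σ)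
    where
    ρ σ : Aut
    ρ = false , a ⊖ u
    σ = true , a ⊕ u
    member : ∀ g → act g u ≡ a → InΩ u v w a (act g v) (act g w)
    member g hit = g , ≡.cong (_, act g v , act g w) hit
    ρ≢σ : (act ρ v , act ρ w) ≢ (act σ v , act σ w)
    ρ≢σ ρvw≡σvw = d⁻¹≉d (begin
      δ u v w ⁻¹                           ≈⟨ δ-reflection u v w (a ⊕ u) ⟨
      δ (act σ u) (act σ v) (act σ w)      ≡⟨ ≡.cong₂ (λ a′ bc → δ a′ (proj₁ bc) (proj₂ bc))
                                                      σu≡ρu (≡.sym ρvw≡σvw) ⟩
      δ (act ρ u) (act ρ v) (act ρ w)      ≈⟨ δ-rotation u v w (a ⊖ u) ⟩
      δ u v w                              ∎)
      where
      open import Relation.Binary.Reasoning.Setoid X².setoid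
      σu≡ρu : act σ u ≡ act ρ u
      σu≡ρu = ≡.trans (reflection-hit u a) (≡.sym (rotation-hit u a))

  ∣Ω∣≡N⇒selfInverse : ∀ {u v w} → ∣Ω∣ u v w ≡ N → δ u v w ⁻¹ ≈ δ u v w
  ∣Ω∣≡N⇒selfInverse {u} {v} {w} ∣Ω∣≡N = decidable-stable (δ u v w ⁻¹ ≈? δ u v w) λ d⁻¹≉d →
    <⇒≱ (m<m*n N 2 (s≤s (s≤s z≤n))) (≤-trans (n*m≤∑ℕ _ (fibre≥2 d⁻¹≉d)) (≤-reflexive ∣Ω∣≡N))

  χΩ-neighbours : ∀ {u v w u′ v′ w′ a b c a₊ b₊ c₊ a₋ b₋ c₋ t} →
    δ u v w ⁻¹ ≈ δ u v w → ¬ t ⁻¹ ≈ t →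
    δ a₊ b₊ c₊ ≈ δ a b c ∙ t → δ a₋ b₋ c₋ ≈ δ a b c - t → δ u′ v′ w′ ≈ δ u v w - t →
    χΩ u v w a₊ b₊ c₊ ℤ.+ χΩ u v w a₋ b₋ c₋ ≡ χΩ u′ v′ w′ a b c
  χΩ-neighbours {u} {v} {w} {u′} {v′} {w′} {a} {b} {c} {a₊} {b₊} {c₊} {a₋} {b₋} {c₋} {t}
                d⁻¹≈d t⁻¹≉t δ₊≈ δ₋≈ δ′≈ = begin
    χΩ u v w a₊ b₊ c₊ ℤ.+ χΩ u v w a₋ b₋ c₋
      ≡⟨ ≡.cong₂ ℤ._+_ (χΩ≡χ± u v w a₊ b₊ c₊) (χΩ≡χ± u v w a₋ b₋ c₋) ⟩
    χ± _≈?_ d (δ a₊ b₊ c₊) ℤ.+ χ± _≈?_ d (δ a₋ b₋ c₋)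
      ≡⟨ ≡.cong₂ ℤ._+_ (χ±-cong _≈?_ δ₊≈ X².refl) (χ±-cong _≈?_ δ₋≈ X².refl) ⟩
    χ± _≈?_ d (δ a b c ∙ t) ℤ.+ χ± _≈?_ d (δ a b c - t)
      ≡⟨ χ±-neighbours _≈?_ d⁻¹≈d t⁻¹≉t ⟩
    χ± _≈?_ (d - t) (δ a b c)
      ≡⟨ χ±-cong _≈?_ X².refl δ′≈ ⟨
    χ± _≈?_ (δ u′ v′ w′) (δ a b c)
      ≡⟨ χΩ≡χ± u′ v′ w′ a b c ⟨
    χΩ u′ v′ w′ a b c
      ∎
    where
    open ≡-Reasoning
    d = δ u v w

  χΩ-mirror : ∀ {u v w u₋ v₋ w₋ u₊ v₊ w₊ t} → δ u v w ⁻¹ ≈ δ u v w →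
    δ u₋ v₋ w₋ ≈ δ u v w - t → δ u₊ v₊ w₊ ≈ δ u v w ∙ t →
    ∀ a b c → χΩ u₋ v₋ w₋ a b c ≡ χΩ u₊ v₊ w₊ a b c
  χΩ-mirror {u} {v} {w} {u₋} {v₋} {w₋} {u₊} {v₊} {w₊} {t} d⁻¹≈d δ₋≈ δ₊≈ a b c = begin
    χΩ u₋ v₋ w₋ a b c                  ≡⟨ χΩ≡χ± u₋ v₋ w₋ a b c ⟩
    χ± _≈?_ (δ u₋ v₋ w₋) (δ a b c)     ≡⟨ χ±-cong _≈?_ X².refl δ₋≈ ⟩
    χ± _≈?_ (δ u v w - t) (δ a b c)    ≡⟨ χ±-mirror _≈?_ d⁻¹≈d ⟩
    χ± _≈?_ (δ u v w ∙ t) (δ a b c)    ≡⟨ χ±-cong _≈?_ X².refl δ₊≈ ⟨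
    χ± _≈?_ (δ u₊ v₊ w₊) (δ a b c)     ≡⟨ χΩ≡χ± u₊ v₊ w₊ a b c ⟨
    χΩ u₊ v₊ w₊ a b c                  ∎
    where open ≡-Reasoning

  δ-⊕₁ : ∀ a b c s → δ (a ⊕ s) b c ≈ δ a b c ∙ (s , ℤ/N.ε)
  δ-⊕₁ a b c s = ℤ/N.xy∙z≈xz∙y a s (⊝ c) , ≡.sym (ℤ/N.identityʳ (b ⊖ c))

  δ-⊖₁ : ∀ a b c s → δ (a ⊖ s) b c ≈ δ a b c - (s , ℤ/N.ε)
  δ-⊖₁ a b c s = X².trans (δ-⊕₁ a b c (⊝ s)) (X².∙-congˡ {δ a b c} (≡.refl , ≡.sym ℤ/N.ε⁻¹≈ε))

  δ-⊕₂ : ∀ a b c s → δ a (b ⊕ s) c ≈ δ a b c ∙ (ℤ/N.ε , s)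
  δ-⊕₂ a b c s = ≡.sym (ℤ/N.identityʳ (a ⊖ c)) , ℤ/N.xy∙z≈xz∙y b s (⊝ c)

  δ-⊖₂ : ∀ a b c s → δ a (b ⊖ s) c ≈ δ a b c - (ℤ/N.ε , s)
  δ-⊖₂ a b c s = X².trans (δ-⊕₂ a b c (⊝ s)) (X².∙-congˡ {δ a b c} (≡.sym ℤ/N.ε⁻¹≈ε , ≡.refl))

  δ-⊕₃ : ∀ a b c s → δ a b (c ⊕ s) ≈ δ a b c - (s , s)
  δ-⊕₃ a b c s = ℤ/N.x-yz≈x-y-z a c s , ℤ/N.x-yz≈x-y-z b c s

  module Neighbours {x y : X} (d⁻¹≈d : δ x y (lbl 0) ⁻¹ ≈ δ x y (lbl 0)) (3≤N : 3 ≤ N) where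

    private
      o e : X
      o = lbl 0
      e = lbl 1

      ⊝e≢e : ⊝ e ≢ e
      ⊝e≢e = ⊝1≢1 3≤N

      δ-lbl[N∸1] : δ x y (lbl (N ∸ 1)) ≈ δ x y o - (⊝ e , ⊝ e)
      δ-lbl[N∸1] = X².trans (X².reflexive (≡.cong (δ x y) N∸1≡o⊖e)) (δ-⊕₃ x y o (⊝ e))
        where
        N∸1≡o⊖e : lbl (N ∸ 1) ≡ o ⊖ e
        N∸1≡o⊖e = ≡.trans (lbl[N∸1]≡⊝1 (<⇒≤ 3≤N)) (≡.sym (ℤ/N.identityˡ (⊝ e)))

      δ-lbl1 : δ x y e ≈ δ x y o - (e , e)
      δ-lbl1 = X².trans (X².reflexive (≡.cong (δ x y) (≡.sym (ℤ/N.identityˡ e)))) (δ-⊕₃ x y o e)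

    A⁽¹⁾χΩ : ∀ a b c → A⁽¹⁾ (χΩ x y o) a b c ≡ χΩ (x ⊖ e) y o a b c
    A⁽¹⁾χΩ a b c = ≡.trans (A₁-shift (λ a′ → χΩ x y o a′ b c) a)
      (χΩ-neighbours {w = o} d⁻¹≈d (λ (⊝e≡e , _) → ⊝e≢e ⊝e≡e)
                     (δ-⊕₁ a b c e) (δ-⊖₁ a b c e) (δ-⊖₁ x y o e))

    A⁽²⁾χΩ : ∀ a b c → A⁽²⁾ (χΩ x y o) a b c ≡ χΩ x (y ⊖ e) o a b c
    A⁽²⁾χΩ a b c = ≡.trans (A₁-shift (λ b′ → χΩ x y o a b′ c) b)
      (χΩ-neighbours {w = o} d⁻¹≈d (λ (_ , ⊝e≡e) → ⊝e≢e ⊝e≡e)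
                     (δ-⊕₂ a b c e) (δ-⊖₂ a b c e) (δ-⊖₂ x y o e))

    A⁽³⁾χΩ : ∀ a b c → A⁽³⁾ (χΩ x y o) a b c ≡ χΩ x y (lbl (N ∸ 1)) a b c
    A⁽³⁾χΩ a b c = ≡.trans (A₁-shift (λ c′ → χΩ x y o a b c′) c)
      (χΩ-neighbours {w = o} d⁻¹≈d (λ (⊝⊝e≡⊝e , _) → ⊝e≢e (ℤ/N.⁻¹-injective ⊝⊝e≡⊝e))
                     (δ-⊕₃ a b c e) (δ-⊕₃ a b c (⊝ e)) δ-lbl[N∸1])

    χΩ-x∓1 : ∀ a b c → χΩ (x ⊖ e) y o a b c ≡ χΩ (x ⊕ e) y o a b c
    χΩ-x∓1 = χΩ-mirror {w = o} d⁻¹≈d (δ-⊖₁ x y o e) (δ-⊕₁ x y o e)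

    χΩ-y∓1 : ∀ a b c → χΩ x (y ⊖ e) o a b c ≡ χΩ x (y ⊕ e) o a b c
    χΩ-y∓1 = χΩ-mirror {w = o} d⁻¹≈d (δ-⊖₂ x y o e) (δ-⊕₂ x y o e)

    χΩ-z∓1 : ∀ a b c → χΩ x y (lbl (N ∸ 1)) a b c ≡ χΩ x y e a b c
    χΩ-z∓1 = χΩ-mirror {w = o} d⁻¹≈d δ-lbl[N∸1] δ-lbl1

3≤N : ∀ {D N} → 2 ≤ D → N ≡ 2 * D ⊎ N ≡ suc (2 * D) → 3 ≤ N
3≤N 2≤D (inj₁ ≡.refl) = ≤-trans (n≤1+n 3) (*-monoʳ-≤ 2 2≤D)
3≤N 2≤D (inj₂ ≡.refl) = ≤-trans (n≤1+n 3) (≤-trans (*-monoʳ-≤ 2 2≤D) (n≤1+n _))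

lemma7p5 : (D : ℕ) → 2 ≤ D → (N : ℕ) .{{_ : NonZero N}} →
    (N ≡ 2 * D ⊎ N ≡ suc (2 * D)) →
    let open Cycle N in
    (x y : X) → InO D x y → ∣Ω∣ x y (lbl 0) ≡ N →
      (∀ a b c →
          (A⁽¹⁾ (χΩ x y (lbl 0)) a b c ≡ χΩ (x ⊖ lbl 1) y (lbl 0) a b c)
        × (χΩ (x ⊖ lbl 1) y (lbl 0) a b c ≡ χΩ (x ⊕ lbl 1) y (lbl 0) a b c))
    × (∀ a b c →
          (A⁽²⁾ (χΩ x y (lbl 0)) a b c ≡ χΩ x (y ⊖ lbl 1) (lbl 0) a b c)
        × (χΩ x (y ⊖ lbl 1) (lbl 0) a b c ≡ χΩ x (y ⊕ lbl 1) (lbl 0) a b c))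
    × (∀ a b c →
          (A⁽³⁾ (χΩ x y (lbl 0)) a b c ≡ χΩ x y (lbl (N ∸ 1)) a b c)
        × (χΩ x y (lbl (N ∸ 1)) a b c ≡ χΩ x y (lbl 1) a b c))
lemma7p5 D 2≤D N N≡2D∨2D+1 x y _ ∣Ω∣≡N =
  (λ a b c → A⁽¹⁾χΩ a b c , χΩ-x∓1 a b c) ,
  (λ a b c → A⁽²⁾χΩ a b c , χΩ-y∓1 a b c) ,
  (λ a b c → A⁽³⁾χΩ a b c , χΩ-z∓1 a b c)
  where
  open Orbits N
  open Neighbours (∣Ω∣≡N⇒selfInverse ∣Ω∣≡N) (3≤N 2≤D N≡2D∨2D+1)
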